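{- Let $G$ be a finite simple graph and let $c$ be a proper vertex coloring of $G$ with $k$ colors. Let $B_c$ be the set of vertices $v$ with $d(v)\ge 2$ all of whose neighbours receive the same color under $c$. Then $G$ has a dynamic coloring with at most $k+|B_c|$ colors.
   Context: A proper vertex coloring is dynamic if for every vertex $v$ of degree at least $2$, the neighbours of $v$ receive at least two different colors. $d(v)$ denotes the degree of $v$. -}

module Defs where

open import Data.Nat using (ℕ; _≤_; _≤ᵇ_; _≡ᵇ_)
open import Data.Fin using (Fin; toℕ)
open import Data.Bool using (Bool; true; false; _∧_)
open import Data.List using (List; []; _∷_; length; filter; allFin)
open import Data.Product using (Σ; _×_; ∃; _,_)
open import Relation.Binary.PropositionalEquality using (_≡_; _≢_)
open import Relation.Nullary using (¬_)
open import Data.Bool.Properties using (T?)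

record Graph (n : ℕ) : Set where
  field
    adj   : Fin n → Fin n → Bool
    sym   : ∀ u v → adj u v ≡ adj v u
    irrefl : ∀ v → adj v v ≡ false
open Graph public

neighbours : ∀ {n} → Graph n → Fin n → List (Fin n)
neighbours {n} G v = filter (λ u → T? (adj G v u)) (allFin n)

degree : ∀ {n} → Graph n → Fin n → ℕ
degree G v = length (neighbours G v)

Coloring : ℕ → ℕ → Set
Coloring n k = Fin n → Fin k

Proper : ∀ {n k} → Graph n → Coloring n k → Set
Proper G c = ∀ u v → adj G u v ≡ true → c u ≢ c v

Dynamic : ∀ {n k} → Graph n → Coloring n k → Set
Dynamic G c =
  Proper G c ×
  (∀ v → 2 ≤ degree G v →
     Σ _ λ u → Σ _ λ w → adj G v u ≡ true × adj G v w ≡ true × c u ≢ c w)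

allB : ∀ {A : Set} → (A → Bool) → List A → Bool
allB p [] = true
allB p (x ∷ xs) = p x ∧ allB p xs

monoNbhd : ∀ {n k} → Graph n → Coloring n k → Fin n → Bool
monoNbhd G c v =
  allB (λ u → allB (λ w → toℕ (c u) ≡ᵇ toℕ (c w)) (neighbours G v))
        (neighbours G v)

inB : ∀ {n k} → Graph n → Coloring n k → Fin n → Bool
inB G c v = (2 ≤ᵇ degree G v) ∧ monoNbhd G c v

sizeB : ∀ {n k} → Graph n → Coloring n k → ℕ
sizeB {n} G c = length (filter (λ v → T? (inB G c v)) (allFin n))

module Submission where

-- List the vertices of B_c as b₀, …, b_{m-1} and give the first
-- neighbour of bᵢ the fresh colour k + i (a vertex that is the first
-- neighbour of several bᵢ takes the least such i); every other vertex keeps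
-- its old colour.  Two vertices with equal new colours are either equal or
-- both kept their old, equal colours (a fresh colour names a unique vertex).
-- Hence the recolouring is proper, a vertex of B_c sees its recoloured first
-- neighbour next to a different second neighbour, and a vertex of degree ≥ 2
-- outside B_c already sees two distinct old colours, which stay distinct.

open import Defs hiding (sym)
open import Data.Nat using (ℕ; _+_; _≤_; s≤s)
open import Data.Nat.Properties using (≤⇒≤ᵇ; ≡⇒≡ᵇ)
open import Data.Fin using (Fin; toℕ; _↑ʳ_; _↑ˡ_; splitAt)
open import Data.Fin.Properties using (↑ˡ-injective; ↑ʳ-injective; splitAt-↑ˡ; splitAt-↑ʳ)
  renaming (_≟_ to _≟F_)
open import Data.Bool using (Bool; true; T)
open import Data.Bool.Properties using (T?; T-∧; T-≡)
open import Data.Unit using (tt)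
open import Data.Maybe using (Maybe; just)
open import Data.Maybe.Properties using (≡-dec; just-injective)
open import Data.List using (List; []; _∷_; length; filter; allFin; lookup; head)
open import Data.List.Relation.Unary.Any using (Any; here; there; any?; index)
open import Data.List.Relation.Unary.Any.Properties using (lookup-index)
open import Data.List.Relation.Unary.All using (_∷_)
open import Data.List.Relation.Unary.AllPairs using (_∷_)
open import Data.List.Membership.Propositional using (_∈_; lose)
open import Data.List.Membership.Propositional.Properties using (∈-filter⁺; ∈-filter⁻; ∈-allFin)
open import Data.List.Relation.Unary.Unique.Propositional using (Unique)
open import Data.List.Relation.Unary.Unique.Propositional.Properties as Unique using ()
open import Data.Product using (Σ; _×_; _,_; proj₂)
open import Data.Sum using (_⊎_; inj₁; inj₂; [_,_])
open import Data.Empty using (⊥-elim)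
open import Function.Bundles using (Equivalence)
open import Relation.Nullary using (¬_; Dec; yes; no)
open import Relation.Binary.Definitions using (DecidableEquality)
open import Relation.Binary.PropositionalEquality
  using (_≡_; _≢_; refl; sym; trans; cong; subst; module ≡-Reasoning)

fresh≢old : ∀ {k m} (i : Fin m) (a : Fin k) → k ↑ʳ i ≢ a ↑ˡ m
fresh≢old {k} {m} i a e
  with trans (sym (splitAt-↑ʳ k m i)) (trans (cong (splitAt k) e) (splitAt-↑ˡ k a m))
... | ()

two-elements : ∀ {A : Set} (xs : List A) → 2 ≤ length xs →
  Σ A λ a → Σ A λ b → Σ (List A) λ rest → xs ≡ a ∷ b ∷ rest
two-elements (a ∷ b ∷ rest) _ = a , b , rest , refl
two-elements (_ ∷ []) (s≤s ())

allB-counterexample : ∀ {A : Set} (p : A → Bool) (xs : List A) →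
  ¬ T (allB p xs) → Σ A λ x → x ∈ xs × ¬ T (p x)
allB-counterexample p [] ¬all = ⊥-elim (¬all tt)
allB-counterexample p (x ∷ xs) ¬all with T? (p x)
... | no ¬px = x , here refl , ¬px
... | yes px with allB-counterexample p xs (λ all → ¬all (Equivalence.from T-∧ (px , all)))
...   | y , y∈xs , ¬py = y , there y∈xs , ¬py

-- Recolouring along a list of requests: each request b ∈ xs may name a
-- vertex target b; a named vertex receives the fresh colour given by the
-- position of the first request naming it, all others keep their colour.
module Recolouring {A B : Set} {k : ℕ} (_≟_ : DecidableEquality A)
                   (c : A → Fin k) (target : B → Maybe A) (xs : List B) where

  Targeted : A → Set
  Targeted x = Any (λ b → target b ≡ just x) xs

  targeted? : (x : A) → Dec (Targeted x)
  targeted? x = any? (λ b → ≡-dec _≟_ (target b) (just x)) xs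

  recolour : A → Fin (k + length xs)
  recolour x with targeted? x
  ... | yes p = k ↑ʳ index p
  ... | no _  = c x ↑ˡ length xs

  index-determines : ∀ {x y} (p : Targeted x) (q : Targeted y) → index p ≡ index q → x ≡ y
  index-determines p q e = just-injective (begin
    just _                       ≡⟨ sym (lookup-index p) ⟩
    target (lookup xs (index p)) ≡⟨ cong (λ i → target (lookup xs i)) e ⟩
    target (lookup xs (index q)) ≡⟨ lookup-index q ⟩
    just _                       ∎)
    where open ≡-Reasoning

  fresh-colour-unique : ∀ {x y} → Targeted x → recolour x ≡ recolour y → x ≡ y
  fresh-colour-unique {x} {y} tx e with targeted? x | targeted? y
  ... | yes p | yes q = index-determines p q (↑ʳ-injective k _ _ e)
  ... | yes p | no _  = ⊥-elim (fresh≢old (index p) (c y) e)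
  ... | no ¬p | _     = ⊥-elim (¬p tx)

  recolour-collision : ∀ {x y} → recolour x ≡ recolour y → x ≡ y ⊎ c x ≡ c y
  recolour-collision {x} {y} e with targeted? x | targeted? y
  ... | yes p | yes q = inj₁ (index-determines p q (↑ʳ-injective k _ _ e))
  ... | yes p | no _  = ⊥-elim (fresh≢old (index p) (c y) e)
  ... | no _  | yes q = ⊥-elim (fresh≢old (index q) (c x) (sym e))
  ... | no _  | no _  = inj₂ (↑ˡ-injective (length xs) _ _ e)

  targeted-by : ∀ {b x} → b ∈ xs → target b ≡ just x → Targeted x
  targeted-by = lose

module Neighbourhoods {n : ℕ} (G : Graph n) where

  neighbour-adj : ∀ {v u} → u ∈ neighbours G v → adj G v u ≡ true
  neighbour-adj {v} u∈ =
    Equivalence.to T-≡ (proj₂ (∈-filter⁻ (λ u → T? (adj G v u)) {xs = allFin n} u∈))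

  neighbours-unique : ∀ v → Unique (neighbours G v)
  neighbours-unique v = Unique.filter⁺ (λ u → T? (adj G v u)) (Unique.allFin⁺ n)

  adjacent-distinct : ∀ {u v} → adj G u v ≡ true → u ≢ v
  adjacent-distinct {u} a refl with trans (sym a) (irrefl G u)
  ... | ()

SeesTwoColours : ∀ {n k} → Graph n → Coloring n k → Fin n → Set
SeesTwoColours G c v =
  Σ _ λ u → Σ _ λ w → adj G v u ≡ true × adj G v w ≡ true × c u ≢ c w

module DynamicRecolouring {n k : ℕ} (G : Graph n) (c : Coloring n k) where

  badVertices : List (Fin n)
  badVertices = filter (λ v → T? (inB G c v)) (allFin n)

  firstNeighbour : Fin n → Maybe (Fin n)
  firstNeighbour v = head (neighbours G v)

  open Recolouring _≟F_ c firstNeighbour badVertices public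
  open Neighbourhoods G

  recolour-proper : Proper G c → Proper G recolour
  recolour-proper proper x y a e with recolour-collision e
  ... | inj₁ x≡y   = adjacent-distinct a x≡y
  ... | inj₂ cx≡cy = proper x y a cx≡cy

  -- In B_c: the first neighbour has a colour of its own, unlike the second.
  bad-sees-two : ∀ v → T (inB G c v) → 2 ≤ degree G v → SeesTwoColours G recolour v
  bad-sees-two v bad d with two-elements (neighbours G v) d
  ... | a , b , rest , eq =
    a , b , neighbour-adj a∈ , neighbour-adj b∈ ,
    λ e → a≢b (fresh-colour-unique a-targeted e)
    where
      a∈ : a ∈ neighbours G v
      a∈ = subst (a ∈_) (sym eq) (here refl)
      b∈ : b ∈ neighbours G v
      b∈ = subst (b ∈_) (sym eq) (there (here refl))
      a≢b : a ≢ b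
      a≢b with subst Unique eq (neighbours-unique v)
      ... | (a≢b ∷ _) ∷ _ = a≢b
      a-targeted : Targeted a
      a-targeted = targeted-by (∈-filter⁺ (λ v → T? (inB G c v)) (∈-allFin v) bad) (cong head eq)

  -- Outside B_c: two neighbours with distinct old colours keep them apart.
  good-sees-two : ∀ v → ¬ T (inB G c v) → 2 ≤ degree G v → SeesTwoColours G recolour v
  good-sees-two v good d
    with allB-counterexample _ (neighbours G v)
           (λ mono → good (Equivalence.from T-∧ (≤⇒≤ᵇ d , mono)))
  ... | u , u∈ , ¬allu with allB-counterexample _ (neighbours G v) ¬allu
  ...   | w , w∈ , ¬cu≡cw =
    u , w , neighbour-adj u∈ , neighbour-adj w∈ ,
    λ e → [ (λ u≡w → cu≢cw (cong c u≡w)) , cu≢cw ] (recolour-collision e)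
    where
      cu≢cw : c u ≢ c w
      cu≢cw e = ¬cu≡cw (≡⇒≡ᵇ _ _ (cong toℕ e))

  recolour-dynamic : Proper G c → Dynamic G recolour
  recolour-dynamic proper = recolour-proper proper , sees-two
    where
      sees-two : ∀ v → 2 ≤ degree G v → SeesTwoColours G recolour v
      sees-two v with T? (inB G c v)
      ... | yes bad  = bad-sees-two v bad
      ... | no  good = good-sees-two v good

lemma6 : ∀ {n k} (G : Graph n) (c : Coloring n k) → Proper G c →
    Σ (Coloring n (k + sizeB G c)) (λ c' → Dynamic G c')
lemma6 G c proper = recolour , recolour-dynamic proper
  where open DynamicRecolouring G c
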